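{- Let $\Gamma$ be a totally ordered additive abelian group, $\overline{\Gamma}=\Gamma\sqcup\{\infty\}$, and $E,F$ disjoint finite sets. For a function $\mu\colon\binom{E}{\ast}\times\binom{F}{\ast}\to\overline{\Gamma}$ define $\nu\colon\binom{E\sqcup F}{|E|}\to\overline{\Gamma}$ by $\nu(S)=\mu(E\setminus S,\,S\cap F)$. Then $\mu$ is the minor valuation function of a valuated bimatroid on rows $E$ and columns $F$ if and only if $\nu$ is a valuated matroid of rank $|E|$ on $E\sqcup F$ with $\nu(E)=0$.
   Context: $\binom{E}{\ast}\times\binom{F}{\ast}$ is the set of pairs $(I,J)$ with $I\subseteq E$, $J\subseteq F$, $|I|=|J|$. A function $\mu\colon\binom{E}{\ast}\times\binom{F}{\ast}\to\overline{\Gamma}$ is the minor valuation function of a valuated bimatroid if: (1) $\mu(\emptyset,\emptyset)=0$; (2) for all $(I,J),(I',J')\in\binom{E}{\ast}\times\binom{F}{\ast}$: (i) if $i'\in I'\setminus I$, then either there is $i\in I\setminus I'$ with $\mu(I,J)+\mu(I',J')\ge\mu((I\setminus\{i\})\cup\{i'\},J)+\mu((I'\setminus\{i'\})\cup\{i\},J')$, or there is $j'\in J'\setminus J$ with $\mu(I,J)+\mu(I',J')\ge\mu(I\cup\{i'\},J\cup\{j'\})+\mu(I'\setminus\{i'\},J'\setminus\{j'\})$; (ii) if $j\in J\setminus J'$, then either there is $i\in I\setminus I'$ with $\mu(I,J)+\mu(I',J')\ge\mu(I\setminus\{i\},J\setminus\{j\})+\mu(I'\cup\{i\},J'\cup\{j\})$,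 or there is $j'\in J'\setminus J$ with $\mu(I,J)+\mu(I',J')\ge\mu(I,(J\setminus\{j\})\cup\{j'\})+\mu(I',(J'\setminus\{j'\})\cup\{j\})$. A valuated matroid of rank $r$ on a finite set $X$ is a map $\nu\colon\binom{X}{r}\to\overline{\Gamma}$, not identically $\infty$, such that for all $S,T\in\binom{X}{r}$ and $s\in S\setminus T$ there is $t\in T\setminus S$ with $\nu(S)+\nu(T)\ge\nu((S\setminus\{s\})\cup\{t\})+\nu((T\setminus\{t\})\cup\{s\})$. Here $\infty$ exceeds all elements of $\Gamma$ and $\infty+a=\infty$. -}

module Defs where

open import Level using (Level; suc)
open import Data.Nat using (ℕ) renaming (_+_ to _+ℕ_)
open import Data.Fin using (Fin)
open import Data.Fin.Subset using (Subset; _∈_; _∉_; _∪_; _∩_; _─_; _-_; ∁; ⁅_⁆; ∣_∣; ⊤; ⊥)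
open import Data.Vec using (_++_; take; drop)
open import Data.Product using (Σ; ∃; _×_; _,_)
open import Data.Sum using (_⊎_)
open import Relation.Binary.PropositionalEquality using (_≡_)
open import Relation.Nullary using (¬_)

record TotallyOrderedAbelianGroup (c ℓ : Level) : Set (Level.suc (c Level.⊔ ℓ)) where
  infixl 6 _+_
  infix 4 _≤_
  field
    Carrier   : Set c
    _+_       : Carrier → Carrier → Carrier
    0#        : Carrier
    -_        : Carrier → Carrier
    +-assoc   : ∀ x y z → (x + y) + z ≡ x + (y + z)
    +-comm    : ∀ x y → x + y ≡ y + x
    +-identityˡ : ∀ x → 0# + x ≡ x
    -‿inverseˡ : ∀ x → (- x) + x ≡ 0#
    _≤_       : Carrier → Carrier → Set ℓ
    ≤-refl    : ∀ {x} → x ≤ x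
    ≤-trans   : ∀ {x y z} → x ≤ y → y ≤ z → x ≤ z
    ≤-antisym : ∀ {x y} → x ≤ y → y ≤ x → x ≡ y
    ≤-total   : ∀ x y → x ≤ y ⊎ y ≤ x
    +-monoˡ-≤ : ∀ {x y} z → x ≤ y → x + z ≤ y + z

module _ {c ℓ : Level} (G : TotallyOrderedAbelianGroup c ℓ) where
  open TotallyOrderedAbelianGroup G

  data Γ̄ : Set c where
    fin : Carrier → Γ̄
    ∞   : Γ̄

  infixl 6 _⊕_
  _⊕_ : Γ̄ → Γ̄ → Γ̄
  fin a ⊕ fin b = fin (a + b)
  fin _ ⊕ ∞     = ∞
  ∞     ⊕ _     = ∞

  infix 4 _≼_
  data _≼_ : Γ̄ → Γ̄ → Set (c Level.⊔ ℓ) where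
    fin≼fin : ∀ {a b} → a ≤ b → fin a ≼ fin b
    ≼∞      : ∀ {x} → x ≼ ∞

  infix 4 _≽_
  _≽_ : Γ̄ → Γ̄ → Set (c Level.⊔ ℓ)
  x ≽ y = y ≼ x

  swap : ∀ {k} → Subset k → Fin k → Fin k → Subset k
  swap S s t = (S - s) ∪ ⁅ t ⁆

  add : ∀ {k} → Subset k → Fin k → Subset k
  add S t = S ∪ ⁅ t ⁆

  -- Valuated matroid of rank r on X = Fin k.  ν is given on all subsets,
  -- only its values on r-element subsets matter.
  IsValuatedMatroid : (k r : ℕ) → (Subset k → Γ̄) → Set (c Level.⊔ ℓ)
  IsValuatedMatroid k r ν =
    (Σ (Subset k) λ S → ∣ S ∣ ≡ r × ¬ (ν S ≡ ∞)) ×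
    (∀ (S T : Subset k) → ∣ S ∣ ≡ r → ∣ T ∣ ≡ r →
      ∀ s → s ∈ S → s ∉ T →
      Σ (Fin k) λ t → t ∈ T × t ∉ S ×
        (ν S ⊕ ν T ≽ ν (swap S s t) ⊕ ν (swap T t s)))

  -- Minor valuation function of a valuated bimatroid on rows E = Fin m,
  -- columns F = Fin n.  μ is given on all pairs; only the values on pairs
  -- (I , J) with ∣ I ∣ ≡ ∣ J ∣ matter.
  IsBimatroidMinorValuation : (m n : ℕ) → (Subset m → Subset n → Γ̄) → Set (c Level.⊔ ℓ)
  IsBimatroidMinorValuation m n μ =
    (μ ⊥ ⊥ ≡ fin 0#) ×
    (∀ (I I′ : Subset m) (J J′ : Subset n) → ∣ I ∣ ≡ ∣ J ∣ → ∣ I′ ∣ ≡ ∣ J′ ∣ →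
      (∀ i′ → i′ ∈ I′ → i′ ∉ I →
         (Σ (Fin m) λ i → i ∈ I × i ∉ I′ ×
            (μ I J ⊕ μ I′ J′ ≽ μ (swap I i i′) J ⊕ μ (swap I′ i′ i) J′))
         ⊎
         (Σ (Fin n) λ j′ → j′ ∈ J′ × j′ ∉ J ×
            (μ I J ⊕ μ I′ J′ ≽ μ (add I i′) (add J j′) ⊕ μ (I′ - i′) (J′ - j′))))
      ×
      (∀ j → j ∈ J → j ∉ J′ →
         (Σ (Fin m) λ i → i ∈ I × i ∉ I′ ×
            (μ I J ⊕ μ I′ J′ ≽ μ (I - i) (J - j) ⊕ μ (add I′ i) (add J′ j)))
         ⊎
         (Σ (Fin n) λ j′ → j′ ∈ J′ × j′ ∉ J ×
            (μ I J ⊕ μ I′ J′ ≽ μ I (swap J j j′) ⊕ μ I′ (swap J′ j′ j)))))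

  -- E ⊔ F is modelled as Fin (m +ℕ n): the first m elements are E, the last n are F.
  -- ν(S) = μ(E ∖ S , S ∩ F)
  associatedν : (m n : ℕ) → (Subset m → Subset n → Γ̄) → Subset (m +ℕ n) → Γ̄
  associatedν m n μ S = μ (∁ (take m S)) (drop m S)

  rowSet : (m n : ℕ) → Subset (m +ℕ n)
  rowSet m n = ⊤ {m} ++ ⊥ {n}

{-# OPTIONS --safe #-}

-- A pair (I , J) corresponds to the subset S = (E ∖ I) ⊔ J of E ⊔ F.  This bijection is inverse to
-- the map in associatedν and turns |I| = |J| into |S| = |E|, μ into ν and (∅ , ∅) into E.
-- Exchanging s ∈ S for t ∉ S toggles s and t, and toggling an element of E ⊔ F toggles it in I or
-- in J, so the four cases "s, t a row or a column" of the matroid exchange axiom are exactly the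
-- four alternatives of the bimatroid axiom: a row s ∈ S ∖ T is an i′ ∈ I′ ∖ I as in (i), a column
-- s ∈ S ∖ T is a j ∈ J ∖ J′ as in (ii), and t is the witness i or j′.
module Submission where

open import Defs
open import Level using (Level; _⊔_)
open import Data.Bool using (not)
open import Data.Bool.Properties using (∨-identityʳ; not-involutive)
open import Data.Fin using (Fin; zero; suc; _↑ˡ_; _↑ʳ_; splitAt)
open import Data.Fin.Properties using (splitAt⁻¹-↑ˡ; splitAt⁻¹-↑ʳ)
open import Data.Fin.Subset using (Subset; outside; inside; _∈_; _∉_; _∪_; _-_; ∁; ⁅_⁆; ∣_∣; ⊤; ⊥)
open import Data.Fin.Subset.Properties
  using (p─⊥≡p; ∪-identityʳ; p─q⊆p; x∈p⇒x∉∁p; x∈∁p⇒x∉p; x∉∁p⇒x∈p; x∉p⇒x∈∁p; ∣∁p∣≡n∸∣p∣; ∣p∣≤n; ∣⊥∣≡0)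
open import Data.Nat using (ℕ; _+_)
import Data.Nat as ℕ
open import Data.Nat.Properties using (m∸n+n≡m; +-cancelˡ-≡)
open import Data.Product using (Σ; _×_; _,_; proj₁; uncurry)
open import Data.Sum using (_⊎_; inj₁; inj₂)
open import Data.Vec using (Vec; []; _∷_; here; there; _++_; take; drop; updateAt; _[_]%=_; _[_]=_)
open import Data.Vec.Properties
  using (updateAt-commutes; map-updateAt; map-∘; map-cong; map-id; map-replicate; lookup-++ˡ; lookup-++ʳ;
         []=⇒lookup; lookup⇒[]=; take++drop≡id; ++-injectiveˡ; ++-injectiveʳ)
open import Function using (_∘_)
open import Function.Bundles using (_⇔_; mk⇔; Equivalence)
import Function.Properties.Equivalence as ⇔
open import Relation.Binary.PropositionalEquality
  using (_≡_; _≢_; refl; sym; trans; cong; cong₂; subst; module ≡-Reasoning)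
open import Relation.Nullary using (contradiction)

open Equivalence using (to; from)

private
  variable
    a : Level
    A : Set a
    k m n : ℕ

updateAt-++-↑ˡ : ∀ (xs : Vec A m) (ys : Vec A n) i {f : A → A} →
                 updateAt (xs ++ ys) (i ↑ˡ n) f ≡ updateAt xs i f ++ ys
updateAt-++-↑ˡ (x ∷ xs) ys zero    = refl
updateAt-++-↑ˡ (x ∷ xs) ys (suc i) = cong (x ∷_) (updateAt-++-↑ˡ xs ys i)

updateAt-++-↑ʳ : ∀ (xs : Vec A m) (ys : Vec A n) j {f : A → A} →
                 updateAt (xs ++ ys) (m ↑ʳ j) f ≡ xs ++ updateAt ys j f
updateAt-++-↑ʳ []       ys j = refl
updateAt-++-↑ʳ (x ∷ xs) ys j = cong (x ∷_) (updateAt-++-↑ʳ xs ys j)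

[]=-++-↑ˡ⇔ : ∀ {xs : Vec A m} {ys : Vec A n} {i x} → (xs ++ ys) [ i ↑ˡ n ]= x ⇔ xs [ i ]= x
[]=-++-↑ˡ⇔ {xs = xs} {ys} {i} = mk⇔
  (λ h → lookup⇒[]= i xs (trans (sym (lookup-++ˡ xs ys i)) ([]=⇒lookup h)))
  (λ h → lookup⇒[]= _ (xs ++ ys) (trans (lookup-++ˡ xs ys i) ([]=⇒lookup h)))

[]=-++-↑ʳ⇔ : ∀ {xs : Vec A m} {ys : Vec A n} {j x} → (xs ++ ys) [ m ↑ʳ j ]= x ⇔ ys [ j ]= x
[]=-++-↑ʳ⇔ {xs = xs} {ys} {j} = mk⇔
  (λ h → lookup⇒[]= j ys (trans (sym (lookup-++ʳ xs ys j)) ([]=⇒lookup h)))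
  (λ h → lookup⇒[]= _ (xs ++ ys) (trans (lookup-++ʳ xs ys j) ([]=⇒lookup h)))

take-++ : ∀ (xs : Vec A m) (ys : Vec A n) → take m (xs ++ ys) ≡ xs
take-++ {m = m} xs ys = ++-injectiveˡ (take m (xs ++ ys)) xs (take++drop≡id m (xs ++ ys))

drop-++ : ∀ (xs : Vec A m) (ys : Vec A n) → drop m (xs ++ ys) ≡ ys
drop-++ {m = m} xs ys = ++-injectiveʳ (take m (xs ++ ys)) xs (take++drop≡id m (xs ++ ys))

∁-involutive : ∀ (p : Subset k) → ∁ (∁ p) ≡ p
∁-involutive p = trans (sym (map-∘ not not p)) (trans (map-cong not-involutive p) (map-id p))

∁⊥≡⊤ : ∁ (⊥ {k}) ≡ ⊤
∁⊥≡⊤ {k} = map-replicate not outside k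

∣p++q∣≡∣p∣+∣q∣ : ∀ (p : Subset m) (q : Subset n) → ∣ p ++ q ∣ ≡ ∣ p ∣ + ∣ q ∣
∣p++q∣≡∣p∣+∣q∣ []            q = refl
∣p++q∣≡∣p∣+∣q∣ (inside  ∷ p) q = cong ℕ.suc (∣p++q∣≡∣p∣+∣q∣ p q)
∣p++q∣≡∣p∣+∣q∣ (outside ∷ p) q = ∣p++q∣≡∣p∣+∣q∣ p q

∣∁p∣+∣p∣≡n : ∀ (p : Subset n) → ∣ ∁ p ∣ + ∣ p ∣ ≡ n
∣∁p∣+∣p∣≡n p = trans (cong (_+ ∣ p ∣) (∣∁p∣≡n∸∣p∣ p)) (m∸n+n≡m (∣p∣≤n p))

toggle : Subset k → Fin k → Subset k
toggle p x = p [ x ]%= not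

x∈p⇒p-x≡toggle : ∀ {p : Subset k} {x} → x ∈ p → p - x ≡ toggle p x
x∈p⇒p-x≡toggle {p = _ ∷ p} here        = cong (outside ∷_) (p─⊥≡p p)
x∈p⇒p-x≡toggle {p = b ∷ _} (there x∈p) = cong (b ∷_) (x∈p⇒p-x≡toggle x∈p)

x∉p⇒p∪⁅x⁆≡toggle : ∀ {p : Subset k} {x} → x ∉ p → p ∪ ⁅ x ⁆ ≡ toggle p x
x∉p⇒p∪⁅x⁆≡toggle {p = outside ∷ p} {zero}  x∉p = cong (inside ∷_) (∪-identityʳ p)
x∉p⇒p∪⁅x⁆≡toggle {p = inside  ∷ p} {zero}  x∉p = contradiction here x∉p
x∉p⇒p∪⁅x⁆≡toggle {p = b       ∷ p} {suc x} x∉p =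
  cong₂ _∷_ (∨-identityʳ b) (x∉p⇒p∪⁅x⁆≡toggle (x∉p ∘ there))

x∈p∧y∉p⇒p-x∪⁅y⁆≡toggle² : ∀ {p : Subset k} {x y} → x ∈ p → y ∉ p →
                           (p - x) ∪ ⁅ y ⁆ ≡ toggle (toggle p x) y
x∈p∧y∉p⇒p-x∪⁅y⁆≡toggle² {p = p} {x} {y} x∈p y∉p = begin
  (p - x) ∪ ⁅ y ⁆        ≡⟨ x∉p⇒p∪⁅x⁆≡toggle (y∉p ∘ p─q⊆p p ⁅ x ⁆) ⟩
  toggle (p - x) y       ≡⟨ cong (λ q → toggle q y) (x∈p⇒p-x≡toggle x∈p) ⟩
  toggle (toggle p x) y  ∎
  where open ≡-Reasoning

∁-toggle : ∀ (p : Subset k) x → ∁ (toggle p x) ≡ toggle (∁ p) x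
∁-toggle p x = map-updateAt p x refl

associatedSet : Subset m → Subset n → Subset (m + n)
associatedSet I J = ∁ I ++ J

data IsAssociatedSet (m n : ℕ) : Subset (m + n) → Set where
  associated : (I : Subset m) (J : Subset n) → IsAssociatedSet m n (associatedSet I J)

isAssociatedSet : ∀ m (S : Subset (m + n)) → IsAssociatedSet m n S
isAssociatedSet m S = subst (IsAssociatedSet m _) S′≡S (associated (∁ (take m S)) (drop m S))
  where
  S′≡S : associatedSet (∁ (take m S)) (drop m S) ≡ S
  S′≡S = trans (cong (_++ drop m S) (∁-involutive (take m S))) (take++drop≡id m S)

data RowOrColumn (m n : ℕ) : Fin (m + n) → Set where
  row    : (i : Fin m) → RowOrColumn m n (i ↑ˡ n)
  column : (j : Fin n) → RowOrColumn m n (m ↑ʳ j)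

rowOrColumn : ∀ m (z : Fin (m + n)) → RowOrColumn m n z
rowOrColumn m z with splitAt m z in eq
... | inj₁ i = subst (RowOrColumn m _) (splitAt⁻¹-↑ˡ eq) (row i)
... | inj₂ j = subst (RowOrColumn m _) (splitAt⁻¹-↑ʳ eq) (column j)

module _ (I : Subset m) (J : Subset n) where

  ∣associatedSet∣≡m⇔ : ∣ associatedSet I J ∣ ≡ m ⇔ ∣ I ∣ ≡ ∣ J ∣
  ∣associatedSet∣≡m⇔ = mk⇔
    (λ e → sym (+-cancelˡ-≡ ∣ ∁ I ∣ _ _ (trans (sym ∣associatedSet∣) (trans e (sym (∣∁p∣+∣p∣≡n I))))))
    (λ e → trans ∣associatedSet∣ (trans (cong (∣ ∁ I ∣ +_) (sym e)) (∣∁p∣+∣p∣≡n I)))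
    where
    ∣associatedSet∣ : ∣ associatedSet I J ∣ ≡ ∣ ∁ I ∣ + ∣ J ∣
    ∣associatedSet∣ = ∣p++q∣≡∣p∣+∣q∣ (∁ I) J

  ↑ˡ∈associatedSet⇔∉ : ∀ {i} → i ↑ˡ n ∈ associatedSet I J ⇔ i ∉ I
  ↑ˡ∈associatedSet⇔∉ = mk⇔ (x∈∁p⇒x∉p ∘ to []=-++-↑ˡ⇔) (from []=-++-↑ˡ⇔ ∘ x∉p⇒x∈∁p)

  ↑ˡ∉associatedSet⇔∈ : ∀ {i} → i ↑ˡ n ∉ associatedSet I J ⇔ i ∈ I
  ↑ˡ∉associatedSet⇔∈ = mk⇔
    (λ i∉S → x∉∁p⇒x∈p (i∉S ∘ from []=-++-↑ˡ⇔))
    (λ i∈I → x∈p⇒x∉∁p i∈I ∘ to []=-++-↑ˡ⇔)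

  ↑ʳ∈associatedSet⇔∈ : ∀ {j} → m ↑ʳ j ∈ associatedSet I J ⇔ j ∈ J
  ↑ʳ∈associatedSet⇔∈ = []=-++-↑ʳ⇔

  ↑ʳ∉associatedSet⇔∉ : ∀ {j} → m ↑ʳ j ∉ associatedSet I J ⇔ j ∉ J
  ↑ʳ∉associatedSet⇔∉ = mk⇔ (_∘ from []=-++-↑ʳ⇔) (_∘ to []=-++-↑ʳ⇔)

  toggle-associatedSet-↑ˡ : ∀ i → toggle (associatedSet I J) (i ↑ˡ n) ≡ associatedSet (toggle I i) J
  toggle-associatedSet-↑ˡ i = trans (updateAt-++-↑ˡ (∁ I) J i) (cong (_++ J) (sym (∁-toggle I i)))

  toggle-associatedSet-↑ʳ : ∀ j → toggle (associatedSet I J) (m ↑ʳ j) ≡ associatedSet I (toggle J j)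
  toggle-associatedSet-↑ʳ j = updateAt-++-↑ʳ (∁ I) J j

module _ (I : Subset m) (J : Subset n) where
  open ≡-Reasoning

  associatedSet-swap-row-row : ∀ {i′ i} → i′ ∉ I → i ∈ I →
    (associatedSet I J - (i′ ↑ˡ n)) ∪ ⁅ i ↑ˡ n ⁆ ≡ associatedSet ((I - i) ∪ ⁅ i′ ⁆) J
  associatedSet-swap-row-row {i′} {i} i′∉I i∈I = begin
    (associatedSet I J - (i′ ↑ˡ n)) ∪ ⁅ i ↑ˡ n ⁆
      ≡⟨ x∈p∧y∉p⇒p-x∪⁅y⁆≡toggle² (from (↑ˡ∈associatedSet⇔∉ I J) i′∉I)
                                 (from (↑ˡ∉associatedSet⇔∈ I J) i∈I) ⟩
    toggle (toggle (associatedSet I J) (i′ ↑ˡ n)) (i ↑ˡ n)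
      ≡⟨ cong (λ S → toggle S (i ↑ˡ n)) (toggle-associatedSet-↑ˡ I J i′) ⟩
    toggle (associatedSet (toggle I i′) J) (i ↑ˡ n)
      ≡⟨ toggle-associatedSet-↑ˡ (toggle I i′) J i ⟩
    associatedSet (toggle (toggle I i′) i) J
      ≡⟨ cong (λ I′ → associatedSet I′ J) (updateAt-commutes i i′ (λ { refl → i′∉I i∈I }) I) ⟩
    associatedSet (toggle (toggle I i) i′) J
      ≡⟨ cong (λ I′ → associatedSet I′ J) (x∈p∧y∉p⇒p-x∪⁅y⁆≡toggle² i∈I i′∉I) ⟨
    associatedSet ((I - i) ∪ ⁅ i′ ⁆) J ∎

  associatedSet-swap-row-column : ∀ {i j} → i ∉ I → j ∉ J →
    (associatedSet I J - (i ↑ˡ n)) ∪ ⁅ m ↑ʳ j ⁆ ≡ associatedSet (I ∪ ⁅ i ⁆) (J ∪ ⁅ j ⁆)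
  associatedSet-swap-row-column {i} {j} i∉I j∉J = begin
    (associatedSet I J - (i ↑ˡ n)) ∪ ⁅ m ↑ʳ j ⁆
      ≡⟨ x∈p∧y∉p⇒p-x∪⁅y⁆≡toggle² (from (↑ˡ∈associatedSet⇔∉ I J) i∉I)
                                 (from (↑ʳ∉associatedSet⇔∉ I J) j∉J) ⟩
    toggle (toggle (associatedSet I J) (i ↑ˡ n)) (m ↑ʳ j)
      ≡⟨ cong (λ S → toggle S (m ↑ʳ j)) (toggle-associatedSet-↑ˡ I J i) ⟩
    toggle (associatedSet (toggle I i) J) (m ↑ʳ j)
      ≡⟨ toggle-associatedSet-↑ʳ (toggle I i) J j ⟩
    associatedSet (toggle I i) (toggle J j)
      ≡⟨ cong₂ associatedSet (x∉p⇒p∪⁅x⁆≡toggle i∉I) (x∉p⇒p∪⁅x⁆≡toggle j∉J) ⟨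
    associatedSet (I ∪ ⁅ i ⁆) (J ∪ ⁅ j ⁆) ∎

  associatedSet-swap-column-row : ∀ {j i} → j ∈ J → i ∈ I →
    (associatedSet I J - (m ↑ʳ j)) ∪ ⁅ i ↑ˡ n ⁆ ≡ associatedSet (I - i) (J - j)
  associatedSet-swap-column-row {j} {i} j∈J i∈I = begin
    (associatedSet I J - (m ↑ʳ j)) ∪ ⁅ i ↑ˡ n ⁆
      ≡⟨ x∈p∧y∉p⇒p-x∪⁅y⁆≡toggle² (from (↑ʳ∈associatedSet⇔∈ I J) j∈J)
                                 (from (↑ˡ∉associatedSet⇔∈ I J) i∈I) ⟩
    toggle (toggle (associatedSet I J) (m ↑ʳ j)) (i ↑ˡ n)
      ≡⟨ cong (λ S → toggle S (i ↑ˡ n)) (toggle-associatedSet-↑ʳ I J j) ⟩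
    toggle (associatedSet I (toggle J j)) (i ↑ˡ n)
      ≡⟨ toggle-associatedSet-↑ˡ I (toggle J j) i ⟩
    associatedSet (toggle I i) (toggle J j)
      ≡⟨ cong₂ associatedSet (x∈p⇒p-x≡toggle i∈I) (x∈p⇒p-x≡toggle j∈J) ⟨
    associatedSet (I - i) (J - j) ∎

  associatedSet-swap-column-column : ∀ {j j′} → j ∈ J → j′ ∉ J →
    (associatedSet I J - (m ↑ʳ j)) ∪ ⁅ m ↑ʳ j′ ⁆ ≡ associatedSet I ((J - j) ∪ ⁅ j′ ⁆)
  associatedSet-swap-column-column {j} {j′} j∈J j′∉J = begin
    (associatedSet I J - (m ↑ʳ j)) ∪ ⁅ m ↑ʳ j′ ⁆
      ≡⟨ x∈p∧y∉p⇒p-x∪⁅y⁆≡toggle² (from (↑ʳ∈associatedSet⇔∈ I J) j∈J)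
                                 (from (↑ʳ∉associatedSet⇔∉ I J) j′∉J) ⟩
    toggle (toggle (associatedSet I J) (m ↑ʳ j)) (m ↑ʳ j′)
      ≡⟨ cong (λ S → toggle S (m ↑ʳ j′)) (toggle-associatedSet-↑ʳ I J j) ⟩
    toggle (associatedSet I (toggle J j)) (m ↑ʳ j′)
      ≡⟨ toggle-associatedSet-↑ʳ I (toggle J j) j′ ⟩
    associatedSet I (toggle (toggle J j) j′)
      ≡⟨ cong (associatedSet I) (x∈p∧y∉p⇒p-x∪⁅y⁆≡toggle² j∈J j′∉J) ⟨
    associatedSet I ((J - j) ∪ ⁅ j′ ⁆) ∎

module _ {c ℓ : Level} (G : TotallyOrderedAbelianGroup c ℓ) {m n : ℕ} (μ : Subset m → Subset n → Γ̄ G) where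
  open TotallyOrderedAbelianGroup G using (0#)

  private
    infixl 6 _⊕ᴳ_
    infix 4 _≽ᴳ_

    _⊕ᴳ_ : Γ̄ G → Γ̄ G → Γ̄ G
    _⊕ᴳ_ = _⊕_ G

    _≽ᴳ_ : Γ̄ G → Γ̄ G → Set (c ⊔ ℓ)
    _≽ᴳ_ = _≽_ G

    ν : Subset (m + n) → Γ̄ G
    ν = associatedν G m n μ

  ν∘associatedSet : ∀ I J → ν (associatedSet I J) ≡ μ I J
  ν∘associatedSet I J = cong₂ μ (trans (cong ∁ (take-++ (∁ I) J)) (∁-involutive I)) (drop-++ (∁ I) J)

  rowSet≡associatedSet⊥⊥ : rowSet G m n ≡ associatedSet ⊥ (⊥ {n})
  rowSet≡associatedSet⊥⊥ = cong (_++ ⊥) (sym (∁⊥≡⊤ {m}))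

  ν-rowSet : ν (rowSet G m n) ≡ μ ⊥ ⊥
  ν-rowSet = trans (cong ν rowSet≡associatedSet⊥⊥) (ν∘associatedSet ⊥ (⊥ {n}))

  ≽ᴳ-cong⇔ : ∀ {x y z w} → x ≡ y → z ≡ w → (x ≽ᴳ z) ⇔ (y ≽ᴳ w)
  ≽ᴳ-cong⇔ refl refl = ⇔.refl

  ν⊕ν≡μ⊕μ : ∀ {A B A′ B′ S T} → S ≡ associatedSet A B → T ≡ associatedSet A′ B′ →
            ν S ⊕ᴳ ν T ≡ μ A B ⊕ᴳ μ A′ B′
  ν⊕ν≡μ⊕μ {A} {B} {A′} {B′} refl refl = cong₂ _⊕ᴳ_ (ν∘associatedSet A B) (ν∘associatedSet A′ B′)

  exchangeInequality⇔ : ∀ {I J I′ J′ A B A′ B′ S T} → S ≡ associatedSet A B → T ≡ associatedSet A′ B′ →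
    (ν (associatedSet I J) ⊕ᴳ ν (associatedSet I′ J′) ≽ᴳ ν S ⊕ᴳ ν T)
      ⇔ (μ I J ⊕ᴳ μ I′ J′ ≽ᴳ μ A B ⊕ᴳ μ A′ B′)
  exchangeInequality⇔ {I} {J} {I′} {J′} S≡ T≡ =
    ≽ᴳ-cong⇔ (ν⊕ν≡μ⊕μ {I} {J} {I′} {J′} refl refl) (ν⊕ν≡μ⊕μ S≡ T≡)

  MatroidExchangeAt : Subset (m + n) → Subset (m + n) → Fin (m + n) → Set (c ⊔ ℓ)
  MatroidExchangeAt S T s =
    Σ (Fin (m + n)) λ t → t ∈ T × t ∉ S × (ν S ⊕ᴳ ν T ≽ᴳ ν (swap G S s t) ⊕ᴳ ν (swap G T t s))

  RowExchangeAt : Subset m → Subset n → Subset m → Subset n → Fin m → Set (c ⊔ ℓ)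
  RowExchangeAt I J I′ J′ i′ =
    (Σ (Fin m) λ i → i ∈ I × i ∉ I′ ×
      (μ I J ⊕ᴳ μ I′ J′ ≽ᴳ μ (swap G I i i′) J ⊕ᴳ μ (swap G I′ i′ i) J′))
    ⊎
    (Σ (Fin n) λ j′ → j′ ∈ J′ × j′ ∉ J ×
      (μ I J ⊕ᴳ μ I′ J′ ≽ᴳ μ (add G I i′) (add G J j′) ⊕ᴳ μ (I′ - i′) (J′ - j′)))

  ColumnExchangeAt : Subset m → Subset n → Subset m → Subset n → Fin n → Set (c ⊔ ℓ)
  ColumnExchangeAt I J I′ J′ j =
    (Σ (Fin m) λ i → i ∈ I × i ∉ I′ ×
      (μ I J ⊕ᴳ μ I′ J′ ≽ᴳ μ (I - i) (J - j) ⊕ᴳ μ (add G I′ i) (add G J′ j)))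
    ⊎
    (Σ (Fin n) λ j′ → j′ ∈ J′ × j′ ∉ J ×
      (μ I J ⊕ᴳ μ I′ J′ ≽ᴳ μ I (swap G J j j′) ⊕ᴳ μ I′ (swap G J′ j′ j)))

  MatroidExchange : Subset (m + n) → Subset (m + n) → Set (c ⊔ ℓ)
  MatroidExchange S T = ∀ s → s ∈ S → s ∉ T → MatroidExchangeAt S T s

  BimatroidExchange : Subset m → Subset n → Subset m → Subset n → Set (c ⊔ ℓ)
  BimatroidExchange I J I′ J′ =
    (∀ i′ → i′ ∈ I′ → i′ ∉ I → RowExchangeAt I J I′ J′ i′) ×
    (∀ j → j ∈ J → j ∉ J′ → ColumnExchangeAt I J I′ J′ j)

  module _ {I : Subset m} {J : Subset n} {I′ : Subset m} {J′ : Subset n} where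

    rowExchangeAt⇔ : ∀ {i′} → i′ ∉ I → i′ ∈ I′ →
      RowExchangeAt I J I′ J′ i′ ⇔ MatroidExchangeAt (associatedSet I J) (associatedSet I′ J′) (i′ ↑ˡ n)
    rowExchangeAt⇔ {i′} i′∉I i′∈I′ = mk⇔ toMatroid fromMatroid
      where
      S T : Subset (m + n)
      S = associatedSet I J
      T = associatedSet I′ J′

      rows⇔ : ∀ {i} → i ∈ I → i ∉ I′ →
        (ν S ⊕ᴳ ν T ≽ᴳ ν (swap G S (i′ ↑ˡ n) (i ↑ˡ n)) ⊕ᴳ ν (swap G T (i ↑ˡ n) (i′ ↑ˡ n)))
          ⇔ (μ I J ⊕ᴳ μ I′ J′ ≽ᴳ μ (swap G I i i′) J ⊕ᴳ μ (swap G I′ i′ i) J′)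
      rows⇔ i∈I i∉I′ = exchangeInequality⇔
        (associatedSet-swap-row-row I J i′∉I i∈I) (associatedSet-swap-row-row I′ J′ i∉I′ i′∈I′)

      row-column⇔ : ∀ {j′} → j′ ∈ J′ → j′ ∉ J →
        (ν S ⊕ᴳ ν T ≽ᴳ ν (swap G S (i′ ↑ˡ n) (m ↑ʳ j′)) ⊕ᴳ ν (swap G T (m ↑ʳ j′) (i′ ↑ˡ n)))
          ⇔ (μ I J ⊕ᴳ μ I′ J′ ≽ᴳ μ (add G I i′) (add G J j′) ⊕ᴳ μ (I′ - i′) (J′ - j′))
      row-column⇔ j′∈J′ j′∉J = exchangeInequality⇔
        (associatedSet-swap-row-column I J i′∉I j′∉J) (associatedSet-swap-column-row I′ J′ j′∈J′ i′∈I′)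

      toMatroid : RowExchangeAt I J I′ J′ i′ → MatroidExchangeAt S T (i′ ↑ˡ n)
      toMatroid (inj₁ (i , i∈I , i∉I′ , ≽)) =
        i ↑ˡ n , from (↑ˡ∈associatedSet⇔∉ I′ J′) i∉I′ , from (↑ˡ∉associatedSet⇔∈ I J) i∈I ,
        from (rows⇔ i∈I i∉I′) ≽
      toMatroid (inj₂ (j′ , j′∈J′ , j′∉J , ≽)) =
        m ↑ʳ j′ , from (↑ʳ∈associatedSet⇔∈ I′ J′) j′∈J′ , from (↑ʳ∉associatedSet⇔∉ I J) j′∉J ,
        from (row-column⇔ j′∈J′ j′∉J) ≽

      fromMatroid : MatroidExchangeAt S T (i′ ↑ˡ n) → RowExchangeAt I J I′ J′ i′
      fromMatroid (t , t∈T , t∉S , ≽) with rowOrColumn m t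
      ... | row i = inj₁ (i , i∈I , i∉I′ , to (rows⇔ i∈I i∉I′) ≽)
        where
        i∈I : i ∈ I
        i∈I = to (↑ˡ∉associatedSet⇔∈ I J) t∉S
        i∉I′ : i ∉ I′
        i∉I′ = to (↑ˡ∈associatedSet⇔∉ I′ J′) t∈T
      ... | column j′ = inj₂ (j′ , j′∈J′ , j′∉J , to (row-column⇔ j′∈J′ j′∉J) ≽)
        where
        j′∈J′ : j′ ∈ J′
        j′∈J′ = to (↑ʳ∈associatedSet⇔∈ I′ J′) t∈T
        j′∉J : j′ ∉ J
        j′∉J = to (↑ʳ∉associatedSet⇔∉ I J) t∉S

    columnExchangeAt⇔ : ∀ {j} → j ∈ J → j ∉ J′ →
      ColumnExchangeAt I J I′ J′ j ⇔ MatroidExchangeAt (associatedSet I J) (associatedSet I′ J′) (m ↑ʳ j)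
    columnExchangeAt⇔ {j} j∈J j∉J′ = mk⇔ toMatroid fromMatroid
      where
      S T : Subset (m + n)
      S = associatedSet I J
      T = associatedSet I′ J′

      column-row⇔ : ∀ {i} → i ∈ I → i ∉ I′ →
        (ν S ⊕ᴳ ν T ≽ᴳ ν (swap G S (m ↑ʳ j) (i ↑ˡ n)) ⊕ᴳ ν (swap G T (i ↑ˡ n) (m ↑ʳ j)))
          ⇔ (μ I J ⊕ᴳ μ I′ J′ ≽ᴳ μ (I - i) (J - j) ⊕ᴳ μ (add G I′ i) (add G J′ j))
      column-row⇔ i∈I i∉I′ = exchangeInequality⇔
        (associatedSet-swap-column-row I J j∈J i∈I) (associatedSet-swap-row-column I′ J′ i∉I′ j∉J′)

      columns⇔ : ∀ {j′} → j′ ∈ J′ → j′ ∉ J →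
        (ν S ⊕ᴳ ν T ≽ᴳ ν (swap G S (m ↑ʳ j) (m ↑ʳ j′)) ⊕ᴳ ν (swap G T (m ↑ʳ j′) (m ↑ʳ j)))
          ⇔ (μ I J ⊕ᴳ μ I′ J′ ≽ᴳ μ I (swap G J j j′) ⊕ᴳ μ I′ (swap G J′ j′ j))
      columns⇔ j′∈J′ j′∉J = exchangeInequality⇔
        (associatedSet-swap-column-column I J j∈J j′∉J) (associatedSet-swap-column-column I′ J′ j′∈J′ j∉J′)

      toMatroid : ColumnExchangeAt I J I′ J′ j → MatroidExchangeAt S T (m ↑ʳ j)
      toMatroid (inj₁ (i , i∈I , i∉I′ , ≽)) =
        i ↑ˡ n , from (↑ˡ∈associatedSet⇔∉ I′ J′) i∉I′ , from (↑ˡ∉associatedSet⇔∈ I J) i∈I ,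
        from (column-row⇔ i∈I i∉I′) ≽
      toMatroid (inj₂ (j′ , j′∈J′ , j′∉J , ≽)) =
        m ↑ʳ j′ , from (↑ʳ∈associatedSet⇔∈ I′ J′) j′∈J′ , from (↑ʳ∉associatedSet⇔∉ I J) j′∉J ,
        from (columns⇔ j′∈J′ j′∉J) ≽

      fromMatroid : MatroidExchangeAt S T (m ↑ʳ j) → ColumnExchangeAt I J I′ J′ j
      fromMatroid (t , t∈T , t∉S , ≽) with rowOrColumn m t
      ... | row i = inj₁ (i , i∈I , i∉I′ , to (column-row⇔ i∈I i∉I′) ≽)
        where
        i∈I : i ∈ I
        i∈I = to (↑ˡ∉associatedSet⇔∈ I J) t∉S
        i∉I′ : i ∉ I′
        i∉I′ = to (↑ˡ∈associatedSet⇔∉ I′ J′) t∈T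
      ... | column j′ = inj₂ (j′ , j′∈J′ , j′∉J , to (columns⇔ j′∈J′ j′∉J) ≽)
        where
        j′∈J′ : j′ ∈ J′
        j′∈J′ = to (↑ʳ∈associatedSet⇔∈ I′ J′) t∈T
        j′∉J : j′ ∉ J
        j′∉J = to (↑ʳ∉associatedSet⇔∉ I J) t∉S

    bimatroidExchange⇔matroidExchange :
      BimatroidExchange I J I′ J′ ⇔ MatroidExchange (associatedSet I J) (associatedSet I′ J′)
    bimatroidExchange⇔matroidExchange = mk⇔ toMatroid fromMatroid
      where
      toMatroid : BimatroidExchange I J I′ J′ → MatroidExchange (associatedSet I J) (associatedSet I′ J′)
      toMatroid (rowExchange , columnExchange) s s∈S s∉T with rowOrColumn m s
      ... | row i′ = to (rowExchangeAt⇔ i′∉I i′∈I′) (rowExchange i′ i′∈I′ i′∉I)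
        where
        i′∉I : i′ ∉ I
        i′∉I = to (↑ˡ∈associatedSet⇔∉ I J) s∈S
        i′∈I′ : i′ ∈ I′
        i′∈I′ = to (↑ˡ∉associatedSet⇔∈ I′ J′) s∉T
      ... | column j = to (columnExchangeAt⇔ j∈J j∉J′) (columnExchange j j∈J j∉J′)
        where
        j∈J : j ∈ J
        j∈J = to (↑ʳ∈associatedSet⇔∈ I J) s∈S
        j∉J′ : j ∉ J′
        j∉J′ = to (↑ʳ∉associatedSet⇔∉ I′ J′) s∉T

      fromMatroid : MatroidExchange (associatedSet I J) (associatedSet I′ J′) → BimatroidExchange I J I′ J′
      fromMatroid exchange =
        (λ i′ i′∈I′ i′∉I → from (rowExchangeAt⇔ i′∉I i′∈I′)
           (exchange (i′ ↑ˡ n) (from (↑ˡ∈associatedSet⇔∉ I J) i′∉I)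
                               (from (↑ˡ∉associatedSet⇔∈ I′ J′) i′∈I′))) ,
        (λ j j∈J j∉J′ → from (columnExchangeAt⇔ j∈J j∉J′)
           (exchange (m ↑ʳ j) (from (↑ʳ∈associatedSet⇔∈ I J) j∈J)
                              (from (↑ʳ∉associatedSet⇔∉ I′ J′) j∉J′)))

  isBimatroid⇒isValuatedMatroid : IsBimatroidMinorValuation G m n μ → IsValuatedMatroid G (m + n) m ν
  isBimatroid⇒isValuatedMatroid (μ⊥⊥≡0 , bimatroidExchange) =
    (rowSet G m n , ∣rowSet∣≡m , ν-rowSet≢∞) , matroidExchange
    where
    ∣rowSet∣≡m : ∣ rowSet G m n ∣ ≡ m
    ∣rowSet∣≡m = subst (λ S → ∣ S ∣ ≡ m) (sym rowSet≡associatedSet⊥⊥)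
                   (from (∣associatedSet∣≡m⇔ ⊥ ⊥) (trans (∣⊥∣≡0 m) (sym (∣⊥∣≡0 n))))

    ν-rowSet≢∞ : ν (rowSet G m n) ≢ ∞
    ν-rowSet≢∞ ν≡∞ with trans (sym (trans ν-rowSet μ⊥⊥≡0)) ν≡∞
    ... | ()

    matroidExchange : ∀ S T → ∣ S ∣ ≡ m → ∣ T ∣ ≡ m → MatroidExchange S T
    matroidExchange S T ∣S∣≡m ∣T∣≡m with isAssociatedSet m S | isAssociatedSet m T
    ... | associated I J | associated I′ J′ = to bimatroidExchange⇔matroidExchange
      (bimatroidExchange I I′ J J′ (to (∣associatedSet∣≡m⇔ I J) ∣S∣≡m)
                                   (to (∣associatedSet∣≡m⇔ I′ J′) ∣T∣≡m))

  isValuatedMatroid⇒isBimatroid : IsValuatedMatroid G (m + n) m ν → ν (rowSet G m n) ≡ fin 0# →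
                                  IsBimatroidMinorValuation G m n μ
  isValuatedMatroid⇒isBimatroid (_ , matroidExchange) ν-rowSet≡0 =
    trans (sym ν-rowSet) ν-rowSet≡0 , bimatroidExchange
    where
    bimatroidExchange : ∀ I I′ J J′ → ∣ I ∣ ≡ ∣ J ∣ → ∣ I′ ∣ ≡ ∣ J′ ∣ → BimatroidExchange I J I′ J′
    bimatroidExchange I I′ J J′ ∣I∣≡∣J∣ ∣I′∣≡∣J′∣ = from bimatroidExchange⇔matroidExchange
      (matroidExchange (associatedSet I J) (associatedSet I′ J′)
         (from (∣associatedSet∣≡m⇔ I J) ∣I∣≡∣J∣) (from (∣associatedSet∣≡m⇔ I′ J′) ∣I′∣≡∣J′∣))

proposition2p2 : ∀ {c ℓ : Level} (G : TotallyOrderedAbelianGroup c ℓ) (m n : ℕ)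
    (μ : Subset m → Subset n → Γ̄ G) →
    IsBimatroidMinorValuation G m n μ ⇔
      (IsValuatedMatroid G (m + n) m (associatedν G m n μ)
        × associatedν G m n μ (rowSet G m n) ≡ fin (TotallyOrderedAbelianGroup.0# G))
proposition2p2 G m n μ = mk⇔
  (λ bimatroid → isBimatroid⇒isValuatedMatroid G μ bimatroid , trans (ν-rowSet G μ) (proj₁ bimatroid))
  (uncurry (isValuatedMatroid⇒isBimatroid G μ))
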